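{- Let $D$ be a digraph whose underlying graph has girth at least $7$. If $K$ is a maximal clique of the closed in-neighborhood graph ${\mathcal N}^-_c(D)$, then there is a vertex $w$ of $D$ such that $K\subseteq N^+_D[w]$.
   Context: All digraphs are finite, and their arc relation is irreflexive. $N^+_D[v]$ denotes $v$ together with its out-neighbors, $N^-_D[v]$ denotes $v$ together with its in-neighbors. The underlying graph of $D$ is the undirected graph on $V(D)$ where $u,v$ are adjacent iff $uv$ or $vu$ is an arc; girth at least 7 means it has no cycle of length less than 7 (acyclic allowed). The closed in-neighborhood graph ${\mathcal N}^-_c(D)$ is the undirected graph on $V(D)$ in which distinct $u,v$ are adjacent iff $N^-_D[u]\cap N^-_D[v]\neq\emptyset$. -}

module Defs where

open import Level using (0ℓ)
open import Data.Nat using (ℕ; zero; suc; _≤_; _<_)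
open import Data.Fin using (Fin; zero; suc; fromℕ; inject₁)
open import Data.Fin.Subset using (Subset; _∈_; _⊆_)
open import Data.Product using (Σ; ∃; _×_)
open import Data.Sum using (_⊎_)
open import Data.Empty using (⊥)
open import Relation.Nullary using (¬_)
open import Relation.Binary.PropositionalEquality using (_≡_; _≢_)
open import Relation.Binary.Definitions using (Decidable)
open import Function.Definitions using (Injective)

record Digraph (n : ℕ) : Set₁ where
  field
    Arc     : Fin n → Fin n → Set
    arc?    : Decidable Arc
    irrefl  : ∀ v → ¬ Arc v v
open Digraph public

module _ {n : ℕ} (D : Digraph n) where

  InClosedOut : Fin n → Fin n → Set
  InClosedOut w v = (v ≡ w) ⊎ Arc D w v

  InClosedIn : Fin n → Fin n → Set
  InClosedIn v x = (x ≡ v) ⊎ Arc D x v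

  UAdj : Fin n → Fin n → Set
  UAdj u v = Arc D u v ⊎ Arc D v u

  -- a cycle of length (suc m) in the underlying graph: distinct vertices
  -- f 0, …, f m with consecutive ones adjacent and f m adjacent to f 0
  -- (used only for suc m ≥ 3)
  CycleOfLength : ℕ → Set
  CycleOfLength zero = ⊥
  CycleOfLength (suc m) =
    Σ (Fin (suc m) → Fin n) λ f →
      Injective _≡_ _≡_ f
      × (∀ (j : Fin m) → UAdj (f (inject₁ j)) (f (suc j)))
      × UAdj (f (fromℕ m)) (f zero)

  GirthAtLeast7 : Set
  GirthAtLeast7 = ∀ k → 3 ≤ k → k < 7 → ¬ CycleOfLength k

  NcAdj : Fin n → Fin n → Set
  NcAdj u v = (u ≢ v) × ∃ λ x → InClosedIn u x × InClosedIn v x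

  IsClique : Subset n → Set
  IsClique K = ∀ u v → u ∈ K → v ∈ K → u ≢ v → NcAdj u v

  IsMaximalClique : Subset n → Set
  IsMaximalClique K = IsClique K × (∀ K′ → IsClique K′ → K ⊆ K′ → K′ ⊆ K)

-- Any two members u, v of a clique of N⁻_c(D) have a centre: a vertex w with
-- u, v ∈ N⁺[w].  If three members a, b, c had no common centre, their pairwise
-- centres would close up with a, b, c into a cycle of length at most 6.  So a, b, c
-- have a common centre x.  For a fourth member d, if x is neither a centre of
-- {a, b, d} nor of {a, c, d}, then excluding 3- and 4-cycles forces x = a, with b and
-- c as those other centres; but then a → b → d ← c ← a is a 4-cycle.
module Submission where

open import Defs
open import Data.Nat using (ℕ; zero; suc; _≤?_; _<?_)
open import Data.Fin using (Fin; zero; suc; inject₁; fromℕ; _≟_)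
open import Data.Fin.Subset using (Subset; _∈_)
open import Data.Fin.Subset.Properties using (_∈?_)
open import Data.Fin.Properties using (any?)
open import Data.Vec using (Vec; []; _∷_; lookup; head; last)
open import Data.Vec.Relation.Unary.All using ([]; _∷_)
open import Data.Vec.Relation.Unary.Linked using (Linked; [-]; _∷_)
open import Data.Vec.Relation.Unary.Unique.Propositional using (Unique; []; _∷_)
open import Data.Vec.Relation.Unary.Unique.Propositional.Properties using (lookup-injective)
open import Data.List using (List; []; _∷_)
open import Data.List.Relation.Unary.All using (All; []; _∷_)
import Data.List.Relation.Unary.All as All
open import Data.List.Relation.Unary.All.Properties using (¬Any⇒All¬)
open import Data.List.Membership.Propositional using () renaming (_∈_ to _∈ₗ_)
import Data.List.Membership.DecPropositional as DecMembership
open import Data.List.Relation.Binary.Permutation.Propositional using (_↭_; refl; prep; swap)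
import Data.List.Relation.Binary.Permutation.Propositional as ↭
open import Data.List.Relation.Binary.Permutation.Propositional.Properties using (All-resp-↭)
open import Data.Product using (∃; _×_; _,_)
open import Data.Sum using (_⊎_; inj₁; inj₂)
open import Data.Empty using (⊥; ⊥-elim)
open import Relation.Nullary using (yes; no)
open import Relation.Nullary.Decidable using (True; toWitness; decidable-stable; _×-dec_; ¬?)
open import Relation.Binary.PropositionalEquality using (_≡_; _≢_; refl; sym; trans; ≢-sym)

private
  variable
    A : Set
    m : ℕ

lookup-fromℕ : (xs : Vec A (suc m)) → lookup xs (fromℕ m) ≡ last xs
lookup-fromℕ (x ∷ [])     = refl
lookup-fromℕ (x ∷ y ∷ ys) = lookup-fromℕ (y ∷ ys)

linked-lookup : ∀ {R : A → A → Set} {xs : Vec A (suc m)} →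
                Linked R xs → (j : Fin m) → R (lookup xs (inject₁ j)) (lookup xs (suc j))
linked-lookup {xs = _ ∷ _ ∷ _} (r ∷ _)  zero    = r
linked-lookup                  (_ ∷ rs) (suc j) = linked-lookup rs j

module _ {n : ℕ} where

  open DecMembership (_≟_ {n}) using () renaming (_∈?_ to _∈ₗ?_)

  ⊆-or-outside : (K : Subset n) (vs : List (Fin n)) →
                 (∀ {v} → v ∈ K → v ∈ₗ vs) ⊎ ∃ λ v → v ∈ K × All (v ≢_) vs
  ⊆-or-outside K vs with any? (λ v → v ∈? K ×-dec ¬? (v ∈ₗ? vs))
  ... | yes (v , v∈K , v∉vs) = inj₂ (v , v∈K , ¬Any⇒All¬ vs v∉vs)
  ... | no none = inj₁ λ {v} v∈K → decidable-stable (v ∈ₗ? vs) λ v∉vs → none (v , v∈K , v∉vs)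

module _ {n : ℕ} (D : Digraph n) where

  private
    Out : Fin n → Fin n → Set
    Out = InClosedOut D

  arc⇒≢ : ∀ {x y} → Arc D x y → x ≢ y
  arc⇒≢ x→x refl = irrefl D _ x→x

  out⇒arc : ∀ {w v} → v ≢ w → Out w v → Arc D w v
  out⇒arc v≢w (inj₁ v≡w) = ⊥-elim (v≢w v≡w)
  out⇒arc _   (inj₂ w→v) = w→v

  uadj-sym : ∀ {u v} → UAdj D u v → UAdj D v u
  uadj-sym (inj₁ u→v) = inj₂ u→v
  uadj-sym (inj₂ v→u) = inj₁ v→u

  closedWalk⇒cycle : (xs : Vec (Fin n) (suc m)) → Unique xs →
                     Linked (UAdj D) xs → UAdj D (last xs) (head xs) → CycleOfLength D (suc m)
  closedWalk⇒cycle xs@(x ∷ _) distinct walk closing =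
    lookup xs , lookup-injective distinct _ _ , linked-lookup walk , closing′
    where
    closing′ : UAdj D (lookup xs (fromℕ _)) x
    closing′ rewrite lookup-fromℕ xs = closing

  Centre : List (Fin n) → Set
  Centre vs = ∃ λ w → All (Out w) vs

  centre-↭ : ∀ {us vs} → us ↭ vs → Centre us → Centre vs
  centre-↭ p (w , ws) = w , All-resp-↭ p ws

  CommonInNeighbour : Fin n → Fin n → Set
  CommonInNeighbour u v = ∃ λ x → Arc D x u × Arc D x v

  common-sym : ∀ {u v} → CommonInNeighbour u v → CommonInNeighbour v u
  common-sym (x , x→u , x→v) = x , x→v , x→u

  Close : Fin n → Fin n → Set
  Close u v = UAdj D u v ⊎ CommonInNeighbour u v

  centre⇒close : ∀ {u v} → u ≢ v → Centre (u ∷ v ∷ []) → Close u v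
  centre⇒close u≢v (w , inj₁ refl ∷ inj₁ refl ∷ []) = ⊥-elim (u≢v refl)
  centre⇒close u≢v (w , inj₁ refl ∷ inj₂ u→v  ∷ []) = inj₁ (inj₁ u→v)
  centre⇒close u≢v (w , inj₂ v→u  ∷ inj₁ refl ∷ []) = inj₁ (inj₂ v→u)
  centre⇒close u≢v (w , inj₂ w→u  ∷ inj₂ w→v  ∷ []) = inj₂ (w , w→u , w→v)

  ncAdj⇒centre : ∀ {u v} → NcAdj D u v → Centre (u ∷ v ∷ [])
  ncAdj⇒centre (_ , x , xu , xv) = x , flip xu ∷ flip xv ∷ []
    where
    flip : ∀ {v x} → InClosedIn D v x → Out x v
    flip (inj₁ x≡v) = inj₁ (sym x≡v)
    flip (inj₂ x→v) = inj₂ x→v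

  clique⇒centre : ∀ {K u v} → IsClique D K → u ∈ K → v ∈ K → u ≢ v → Centre (u ∷ v ∷ [])
  clique⇒centre isClique u∈K v∈K u≢v = ncAdj⇒centre (isClique _ _ u∈K v∈K u≢v)

  Centred : Subset n → Set
  Centred K = ∃ λ w → ∀ v → v ∈ K → Out w v

  centre⇒centred : ∀ {vs K} → Centre vs → (∀ {v} → v ∈ K → v ∈ₗ vs) → Centred K
  centre⇒centred (w , ws) K⊆vs = w , λ v v∈K → All.lookup ws (K⊆vs v∈K)

  module _ (girth : GirthAtLeast7 D) where

    open DecMembership (_≟_ {n}) using () renaming (_∈?_ to _∈ₗ?_)

    noShortCycle : (xs : Vec (Fin n) (suc m)) {_ : True (3 ≤? suc m)} {_ : True (suc m <? 7)} →
                   Unique xs → Linked (UAdj D) xs → UAdj D (last xs) (head xs) → ⊥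
    noShortCycle {m} xs {3≤} {<7} distinct walk closing =
      girth (suc m) (toWitness 3≤) (toWitness <7) (closedWalk⇒cycle xs distinct walk closing)

    centre-twoEdges : ∀ {a b c} → a ≢ b → a ≢ c → b ≢ c →
                      UAdj D a b → UAdj D b c → CommonInNeighbour a c → Centre (a ∷ b ∷ c ∷ [])
    centre-twoEdges {b = b} a≢b a≢c b≢c a-b b-c (z , z→a , z→c) with z ≟ b
    ... | yes refl = z , inj₂ z→a ∷ inj₁ refl ∷ inj₂ z→c ∷ []
    ... | no  z≢b  = ⊥-elim (noShortCycle (_ ∷ _ ∷ _ ∷ _ ∷ [])
          ((arc⇒≢ z→a ∷ z≢b ∷ arc⇒≢ z→c ∷ []) ∷ (a≢b ∷ a≢c ∷ []) ∷ (b≢c ∷ []) ∷ [] ∷ [])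
          (inj₁ z→a ∷ a-b ∷ b-c ∷ [-]) (inj₂ z→c))

    centre-oneEdge : ∀ {a b c} → a ≢ b → a ≢ c → b ≢ c → UAdj D a b →
                     CommonInNeighbour b c → CommonInNeighbour a c → Centre (a ∷ b ∷ c ∷ [])
    centre-oneEdge {a} {b} a≢b a≢c b≢c a-b (y , y→b , y→c) (z , z→a , z→c)
      with y ≟ a | z ≟ b | y ≟ z
    ... | yes refl | _        | _        = y , inj₁ refl ∷ inj₂ y→b ∷ inj₂ y→c ∷ []
    ... | no _     | yes refl | _        = z , inj₂ z→a ∷ inj₁ refl ∷ inj₂ z→c ∷ []
    ... | no _     | no _     | yes refl = ⊥-elim (noShortCycle (_ ∷ _ ∷ _ ∷ [])
          ((arc⇒≢ z→a ∷ arc⇒≢ y→b ∷ []) ∷ (a≢b ∷ []) ∷ [] ∷ [])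
          (inj₁ z→a ∷ a-b ∷ [-]) (inj₂ y→b))
    ... | no y≢a   | no z≢b   | no y≢z   = ⊥-elim (noShortCycle (_ ∷ _ ∷ _ ∷ _ ∷ _ ∷ [])
          ((a≢b ∷ ≢-sym y≢a ∷ a≢c ∷ ≢-sym (arc⇒≢ z→a) ∷ [])
            ∷ (≢-sym (arc⇒≢ y→b) ∷ b≢c ∷ ≢-sym z≢b ∷ [])
            ∷ (arc⇒≢ y→c ∷ y≢z ∷ []) ∷ (≢-sym (arc⇒≢ z→c) ∷ []) ∷ [] ∷ [])
          (a-b ∷ inj₂ y→b ∷ inj₁ y→c ∷ inj₂ z→c ∷ [-]) (inj₁ z→a))

    centre-noEdge : ∀ {a b c} → a ≢ b → a ≢ c → b ≢ c → CommonInNeighbour a b →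
                    CommonInNeighbour b c → CommonInNeighbour a c → Centre (a ∷ b ∷ c ∷ [])
    centre-noEdge {a} {b} {c} a≢b a≢c b≢c (x , x→a , x→b) (y , y→b , y→c) (z , z→a , z→c)
      with x ≟ y | x ≟ z | y ≟ z | x ≟ c | y ≟ a | z ≟ b
    ... | yes refl | _ | _ | _ | _ | _ = x , inj₂ x→a ∷ inj₂ x→b ∷ inj₂ y→c ∷ []
    ... | no _ | yes refl | _ | _ | _ | _ = x , inj₂ x→a ∷ inj₂ x→b ∷ inj₂ z→c ∷ []
    ... | no _ | no _ | yes refl | _ | _ | _ = y , inj₂ z→a ∷ inj₂ y→b ∷ inj₂ y→c ∷ []
    ... | no _ | no _ | no _ | yes refl | _ | _ = x , inj₂ x→a ∷ inj₂ x→b ∷ inj₁ refl ∷ []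
    ... | no _ | no _ | no _ | no _ | yes refl | _ = y , inj₁ refl ∷ inj₂ y→b ∷ inj₂ y→c ∷ []
    ... | no _ | no _ | no _ | no _ | no _ | yes refl = z , inj₂ z→a ∷ inj₁ refl ∷ inj₂ z→c ∷ []
    ... | no x≢y | no x≢z | no y≢z | no x≢c | no y≢a | no z≢b =
        ⊥-elim (noShortCycle (_ ∷ _ ∷ _ ∷ _ ∷ _ ∷ _ ∷ [])
          ((≢-sym (arc⇒≢ x→a) ∷ a≢b ∷ ≢-sym y≢a ∷ a≢c ∷ ≢-sym (arc⇒≢ z→a) ∷ [])
            ∷ (arc⇒≢ x→b ∷ x≢y ∷ x≢c ∷ x≢z ∷ [])
            ∷ (≢-sym (arc⇒≢ y→b) ∷ b≢c ∷ ≢-sym z≢b ∷ [])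
            ∷ (arc⇒≢ y→c ∷ y≢z ∷ []) ∷ (≢-sym (arc⇒≢ z→c) ∷ []) ∷ [] ∷ [])
          (inj₂ x→a ∷ inj₁ x→b ∷ inj₂ y→b ∷ inj₁ y→c ∷ inj₂ z→c ∷ [-]) (inj₁ z→a))

    centre-triple : ∀ {a b c} → a ≢ b → a ≢ c → b ≢ c → Centre (a ∷ b ∷ []) →
                    Centre (b ∷ c ∷ []) → Centre (a ∷ c ∷ []) → Centre (a ∷ b ∷ c ∷ [])
    centre-triple {a} {b} {c} a≢b a≢c b≢c ab bc ac =
      byCases (centre⇒close a≢b ab) (centre⇒close b≢c bc) (centre⇒close a≢c ac)
      where
      bac→abc : b ∷ a ∷ c ∷ [] ↭ a ∷ b ∷ c ∷ []
      bac→abc = swap b a refl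
      acb→abc : a ∷ c ∷ b ∷ [] ↭ a ∷ b ∷ c ∷ []
      acb→abc = prep a (swap c b refl)
      bca→abc : b ∷ c ∷ a ∷ [] ↭ a ∷ b ∷ c ∷ []
      bca→abc = ↭.trans (prep b (swap c a refl)) (swap b a refl)
      byCases : Close a b → Close b c → Close a c → Centre (a ∷ b ∷ c ∷ [])
      byCases (inj₁ x) (inj₁ y) (inj₁ z) = ⊥-elim (noShortCycle (_ ∷ _ ∷ _ ∷ [])
        ((a≢b ∷ a≢c ∷ []) ∷ (b≢c ∷ []) ∷ [] ∷ []) (x ∷ y ∷ [-]) (uadj-sym z))
      byCases (inj₁ x) (inj₁ y) (inj₂ z) = centre-twoEdges a≢b a≢c b≢c x y z
      byCases (inj₁ x) (inj₂ y) (inj₁ z) =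
        centre-↭ bac→abc (centre-twoEdges (≢-sym a≢b) b≢c a≢c (uadj-sym x) z y)
      byCases (inj₂ x) (inj₁ y) (inj₁ z) =
        centre-↭ acb→abc (centre-twoEdges a≢c a≢b (≢-sym b≢c) z (uadj-sym y) x)
      byCases (inj₁ x) (inj₂ y) (inj₂ z) = centre-oneEdge a≢b a≢c b≢c x y z
      byCases (inj₂ x) (inj₁ y) (inj₂ z) =
        centre-↭ bca→abc (centre-oneEdge b≢c (≢-sym a≢b) (≢-sym a≢c) y (common-sym z) (common-sym x))
      byCases (inj₂ x) (inj₂ y) (inj₁ z) =
        centre-↭ acb→abc (centre-oneEdge a≢c a≢b (≢-sym b≢c) z (common-sym y) x)
      byCases (inj₂ x) (inj₂ y) (inj₂ z) = centre-noEdge a≢b a≢c b≢c x y z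

    distinctCentres : ∀ {a b w w′} → a ≢ b → All (Out w) (a ∷ b ∷ []) → All (Out w′) (a ∷ b ∷ []) →
                      w ≢ w′ → (w ≡ a × w′ ≡ b) ⊎ (w ≡ b × w′ ≡ a)
    distinctCentres a≢b (inj₁ refl ∷ inj₁ refl ∷ []) _ _ = ⊥-elim (a≢b refl)
    distinctCentres _ (inj₁ refl ∷ inj₂ _ ∷ []) (inj₁ refl ∷ _ ∷ []) w≢w′ = ⊥-elim (w≢w′ refl)
    distinctCentres _ (inj₁ refl ∷ inj₂ _ ∷ []) (inj₂ _ ∷ inj₁ refl ∷ []) _ = inj₁ (refl , refl)
    distinctCentres a≢b (inj₁ refl ∷ inj₂ a→b ∷ []) (inj₂ w′→a ∷ inj₂ w′→b ∷ []) w≢w′ =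
      ⊥-elim (noShortCycle (_ ∷ _ ∷ _ ∷ []) ((a≢b ∷ w≢w′ ∷ []) ∷ (≢-sym (arc⇒≢ w′→b) ∷ []) ∷ [] ∷ [])
                           (inj₁ a→b ∷ inj₂ w′→b ∷ [-]) (inj₁ w′→a))
    distinctCentres _ (inj₂ _ ∷ inj₁ refl ∷ []) (inj₁ refl ∷ _ ∷ []) _ = inj₂ (refl , refl)
    distinctCentres _ (inj₂ _ ∷ inj₁ refl ∷ []) (inj₂ _ ∷ inj₁ refl ∷ []) w≢w′ = ⊥-elim (w≢w′ refl)
    distinctCentres a≢b (inj₂ b→a ∷ inj₁ refl ∷ []) (inj₂ w′→a ∷ inj₂ w′→b ∷ []) w≢w′ =
      ⊥-elim (noShortCycle (_ ∷ _ ∷ _ ∷ []) ((a≢b ∷ ≢-sym (arc⇒≢ w′→a) ∷ []) ∷ (w≢w′ ∷ []) ∷ [] ∷ [])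
                           (inj₂ b→a ∷ inj₂ w′→b ∷ [-]) (inj₁ w′→a))
    distinctCentres a≢b (inj₂ _ ∷ inj₂ _ ∷ []) (inj₁ refl ∷ inj₁ b≡a ∷ []) _ = ⊥-elim (a≢b (sym b≡a))
    distinctCentres a≢b (inj₂ w→a ∷ inj₂ w→b ∷ []) (inj₁ refl ∷ inj₂ a→b ∷ []) _ =
      ⊥-elim (noShortCycle (_ ∷ _ ∷ _ ∷ []) ((arc⇒≢ w→a ∷ arc⇒≢ w→b ∷ []) ∷ (a≢b ∷ []) ∷ [] ∷ [])
                           (inj₁ w→a ∷ inj₁ a→b ∷ [-]) (inj₂ w→b))
    distinctCentres a≢b (inj₂ w→a ∷ inj₂ w→b ∷ []) (inj₂ b→a ∷ inj₁ refl ∷ []) _ =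
      ⊥-elim (noShortCycle (_ ∷ _ ∷ _ ∷ []) ((arc⇒≢ w→a ∷ arc⇒≢ w→b ∷ []) ∷ (a≢b ∷ []) ∷ [] ∷ [])
                           (inj₁ w→a ∷ inj₂ b→a ∷ [-]) (inj₂ w→b))
    distinctCentres a≢b (inj₂ w→a ∷ inj₂ w→b ∷ []) (inj₂ w′→a ∷ inj₂ w′→b ∷ []) w≢w′ =
      ⊥-elim (noShortCycle (_ ∷ _ ∷ _ ∷ _ ∷ [])
               ((arc⇒≢ w→a ∷ w≢w′ ∷ arc⇒≢ w→b ∷ []) ∷ (≢-sym (arc⇒≢ w′→a) ∷ a≢b ∷ [])
                 ∷ (arc⇒≢ w′→b ∷ []) ∷ [] ∷ [])
               (inj₁ w→a ∷ inj₂ w′→a ∷ inj₁ w′→b ∷ [-]) (inj₂ w→b))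

    centre-extend : ∀ {a b c d x} → a ≢ b → a ≢ c → a ≢ d → b ≢ c → b ≢ d → c ≢ d →
                    All (Out x) (a ∷ b ∷ c ∷ []) → Centre (a ∷ b ∷ d ∷ []) → Centre (a ∷ c ∷ d ∷ []) →
                    Out x d
    centre-extend {x = x} a≢b a≢c a≢d b≢c b≢d c≢d
                  (x-a ∷ x-b ∷ x-c ∷ []) (y , y-a ∷ y-b ∷ y-d ∷ []) (z , z-a ∷ z-c ∷ z-d ∷ [])
      with x ≟ y | x ≟ z
    ... | yes refl | _        = y-d
    ... | no _     | yes refl = z-d
    ... | no x≢y   | no x≢z
      with distinctCentres a≢b (x-a ∷ x-b ∷ []) (y-a ∷ y-b ∷ []) x≢y
         | distinctCentres a≢c (x-a ∷ x-c ∷ []) (z-a ∷ z-c ∷ []) x≢z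
    ... | inj₁ (refl , refl) | inj₁ (_ , refl) = ⊥-elim (noShortCycle (_ ∷ _ ∷ _ ∷ _ ∷ [])
          ((a≢b ∷ a≢d ∷ a≢c ∷ []) ∷ (b≢d ∷ b≢c ∷ []) ∷ (≢-sym c≢d ∷ []) ∷ [] ∷ [])
          (inj₁ (out⇒arc (≢-sym a≢b) x-b) ∷ inj₁ (out⇒arc (≢-sym b≢d) y-d)
            ∷ inj₂ (out⇒arc (≢-sym c≢d) z-d) ∷ [-])
          (inj₂ (out⇒arc (≢-sym a≢c) x-c)))
    ... | inj₁ (refl , _) | inj₂ (a≡c , _) = ⊥-elim (a≢c a≡c)
    ... | inj₂ (x≡b , _)  | inj₁ (x≡a , _) = ⊥-elim (a≢b (trans (sym x≡a) x≡b))
    ... | inj₂ (x≡b , _)  | inj₂ (x≡c , _) = ⊥-elim (b≢c (trans (sym x≡b) x≡c))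

    clique⇒centre₃ : ∀ {K a b c} → IsClique D K → a ∈ K → b ∈ K → c ∈ K → a ≢ b → a ≢ c → b ≢ c →
                     Centre (a ∷ b ∷ c ∷ [])
    clique⇒centre₃ isClique a∈K b∈K c∈K a≢b a≢c b≢c = centre-triple a≢b a≢c b≢c
      (clique⇒centre isClique a∈K b∈K a≢b)
      (clique⇒centre isClique b∈K c∈K b≢c)
      (clique⇒centre isClique a∈K c∈K a≢c)

    clique-centred : ∀ {K a b c} → IsClique D K → a ∈ K → b ∈ K → c ∈ K → a ≢ b → a ≢ c → b ≢ c →
                     Centred K
    clique-centred {K} {a} {b} {c} isClique a∈K b∈K c∈K a≢b a≢c b≢c
      with clique⇒centre₃ isClique a∈K b∈K c∈K a≢b a≢c b≢c
    ... | x , x-abc = x , covers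
      where
      covers : ∀ d → d ∈ K → Out x d
      covers d d∈K with d ∈ₗ? (a ∷ b ∷ c ∷ [])
      ... | yes d∈abc = All.lookup x-abc d∈abc
      ... | no  d∉abc with ¬Any⇒All¬ _ d∉abc
      ...   | d≢a ∷ d≢b ∷ d≢c ∷ [] =
        centre-extend a≢b a≢c (≢-sym d≢a) b≢c (≢-sym d≢b) (≢-sym d≢c) x-abc
          (clique⇒centre₃ isClique a∈K b∈K d∈K a≢b (≢-sym d≢a) (≢-sym d≢b))
          (clique⇒centre₃ isClique a∈K c∈K d∈K a≢c (≢-sym d≢a) (≢-sym d≢c))

lemma4p2 : ∀ {n : ℕ} (D : Digraph (suc n)) → GirthAtLeast7 D →
    (K : Subset (suc n)) → IsMaximalClique D K →
    ∃ λ (w : Fin (suc n)) → ∀ v → v ∈ K → InClosedOut D w v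
lemma4p2 D girth K (isClique , _) with ⊆-or-outside K []
... | inj₁ K⊆∅ = centre⇒centred D (zero , []) K⊆∅
... | inj₂ (a , a∈K , []) with ⊆-or-outside K (a ∷ [])
... | inj₁ K⊆a = centre⇒centred D (a , inj₁ refl ∷ []) K⊆a
... | inj₂ (b , b∈K , b≢a ∷ []) with ⊆-or-outside K (a ∷ b ∷ [])
... | inj₁ K⊆ab = centre⇒centred D (clique⇒centre D isClique a∈K b∈K (≢-sym b≢a)) K⊆ab
... | inj₂ (c , c∈K , c≢a ∷ c≢b ∷ []) =
  clique-centred D girth isClique a∈K b∈K c∈K (≢-sym b≢a) (≢-sym c≢a) (≢-sym c≢b)
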